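{- Let $n\ge 0$, $0\le i<3^n$, and $V=C_n(i)$. Then $(C_{n+1}(3i),C_{n+1}(3i+1),C_{n+1}(3i+2))$ is either $(V,3V,V)$ or $(V/3,V/3,V/3)$.
   Context: The unit weight-$3$ Stern–Brocot sequences $SB_n$ ($n\ge0$): $SB_0=(\frac{0}{1},\frac{1}{1})$, and $SB_{n+1}$ is obtained from $SB_n$ by keeping all its terms in order and inserting, between each pair of consecutive terms $\frac{p}{q},\frac{r}{s}$ (in lowest terms, positive denominators), the two fractions $\frac{2p+r}{2q+s}$ and $\frac{p+2r}{q+2s}$, each reduced to lowest terms, in this order. $SB_n$ has $3^n+1$ terms, indexed from $0$. For $0\le i<3^n$, $C_n(i)=qr-ps$ where $\frac{p}{q}$ and $\frac{r}{s}$ are the $i$-th and $(i+1)$-th terms of $SB_n$, written in lowest terms with positive denominators (the cross-difference). $C_n$ denotes the list $(C_n(0),\dots,C_n(3^n-1))$. -}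

module Defs where

open import Data.Nat using (ℕ; zero; suc; _+_; _*_)
open import Data.Nat.GCD using (gcd)
open import Data.Nat.DivMod using (_/_)
open import Data.Integer as ℤ using (ℤ; +_)
open import Data.List using (List; []; _∷_; _++_; head; drop)
open import Data.Maybe using (Maybe; just; nothing)
open import Data.Product using (_×_; _,_)

-- A nonnegative fraction p/q represented by the pair (p , q) with q > 0.
Frac : Set
Frac = ℕ × ℕ

-- reduce to lowest terms by dividing numerator and denominator by their gcd
-- (the gcd is ≥ 1 whenever q > 0; we return (p , q) unchanged if gcd = 0)
reduce : Frac → Frac
reduce (p , q) with gcd p q
... | zero  = (p , q)
... | suc g = (p / suc g , q / suc g)

insert2 : Frac → Frac → List Frac
insert2 (p , q) (r , s) =
  reduce (2 * p + r , 2 * q + s) ∷ reduce (p + 2 * r , q + 2 * s) ∷ []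

step : List Frac → List Frac
step []           = []
step (a ∷ [])     = a ∷ []
step (a ∷ b ∷ xs) = a ∷ insert2 a b ++ step (b ∷ xs)

SB : ℕ → List Frac
SB zero    = (0 , 1) ∷ (1 , 1) ∷ []
SB (suc n) = step (SB n)

cross : Frac → Frac → ℤ
cross (p , q) (r , s) = (+ (q * r)) ℤ.- (+ (p * s))

crossAt : List Frac → ℕ → Maybe ℤ
crossAt xs i with drop i xs
... | a ∷ b ∷ _ = just (cross a b)
... | _         = nothing

-- C_n(i), defined for 0 ≤ i < 3^n (returns nothing out of range)
C : ℕ → ℕ → Maybe ℤ
C n i = crossAt (SB n) i

module Submission where

-- Consecutive terms P, R of SB_n are reduced, their cross-difference det(P, R) is a power 3^k,
-- and R ≡ ±P modulo 3^k coordinatewise.  Under this invariant a common divisor of one of the two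
-- fractions divides 3^k and hence the other, so being reduced propagates along the sequence.
-- The unreduced insertions M = 2P + R and N = P + 2R have cross-differences (V, 3V, V).
-- If R ≡ -P (mod 3^k), or k = 0, then M and N are reduced and the new pairs satisfy the invariant
-- with levels k, k + 1, k.  If R ≡ P (mod 3^(k+1)), then R = P + 3Δ, M = 3(P + Δ) and
-- N = 3(P + 2Δ), so after reduction P, P + Δ, P + 2Δ, R is an arithmetic progression whose three
-- cross-differences all equal V/3, and the invariant holds with level k.

open import Defs
open import Data.Nat.Base as ℕ using (ℕ; zero; suc)
import Data.Nat.Divisibility as ℕ
import Data.Nat.Properties as ℕ
open import Data.Nat.GCD using (gcd; c*gcd[m,n]≡gcd[cm,cn])
open import Data.Nat.Coprimality using (Coprime; coprime⇒gcd≡1; gcd≡1⇒coprime)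
open import Data.Nat.DivMod using (_/_; n/1≡n; m*n/n≡m)
open import Data.Integer as ℤ using (ℤ; +_; -[1+_])
open import Data.List using (List; []; _∷_; _++_; drop)
open import Data.List.Properties using (drop-drop; drop-[])
open import Data.List.Relation.Unary.Linked using (Linked; []; [-]; _∷_; head; tail)
open import Data.Maybe using (Maybe; just; nothing)
open import Data.Product using (Σ-syntax; ∃-syntax; _×_; _,_; proj₁; proj₂)
open import Data.Sum as Sum using (_⊎_; inj₁; inj₂)
open import Relation.Binary.PropositionalEquality
open import Relation.Nullary using (contradiction)

-- Integer arithmetic is opened only inside this block, since the statement of lemma11 uses ℕ's
-- _+_ and _*_.
module _ where
  open import Data.Integer.Base using (_+_; _-_; _*_; -_; _^_)
  open import Data.Integer.Properties using (pos-+; pos-*; +-injective; *-cancelˡ-≡; neg-involutive)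
  open import Data.Integer.Divisibility.Signed
    using (_∣_; divides; ∣ᵤ⇒∣; ∣⇒∣ᵤ; ∣-trans; ∣m∣n⇒∣m-n; ∣m+n∣m⇒∣n; ∣m+n∣n⇒∣m; ∣m⇒∣-m;
           ∣n⇒∣m*n; ∣m⇒∣m*n; *-monoʳ-∣)
  open import Data.Integer.Tactic.RingSolver using (solve-∀)

  ℤ² : Set
  ℤ² = ℤ × ℤ

  infixl 6 _⊕_ _⊖_
  infixr 7 _⊙_
  infix 4 _∣²_

  _⊕_ _⊖_ : ℤ² → ℤ² → ℤ²
  (a , b) ⊕ (c , d) = a + c , b + d
  (a , b) ⊖ (c , d) = a - c , b - d

  _⊙_ : ℤ → ℤ² → ℤ²
  k ⊙ (a , b) = k * a , k * b

  _∣²_ : ℤ → ℤ² → Set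
  k ∣² (a , b) = k ∣ a × k ∣ b

  det : ℤ² → ℤ² → ℤ
  det (p , q) (r , s) = q * r - p * s

  3^ : ℕ → ℤ
  3^ k = (+ 3) ^ k

  ⟦_⟧ : Frac → ℤ²
  ⟦ p , q ⟧ = + p , + q

  Reduced : Frac → Set
  Reduced (p , q) = Coprime p q

  mediantˡ mediantʳ : Frac → Frac → Frac
  mediantˡ (p , q) (r , s) = 2 ℕ.* p ℕ.+ r , 2 ℕ.* q ℕ.+ s
  mediantʳ (p , q) (r , s) = p ℕ.+ 2 ℕ.* r , q ℕ.+ 2 ℕ.* s

  _·_ : ℕ → Frac → Frac
  c · (x , y) = c ℕ.* x , c ℕ.* y

  cross≡det : ∀ P R → cross P R ≡ det ⟦ P ⟧ ⟦ R ⟧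
  cross≡det (p , q) (r , s) = cong₂ _-_ (pos-* q r) (pos-* p s)

  ⟦mediantˡ⟧ : ∀ P R → ⟦ mediantˡ P R ⟧ ≡ + 2 ⊙ ⟦ P ⟧ ⊕ ⟦ R ⟧
  ⟦mediantˡ⟧ (p , q) (r , s) = cong₂ _,_ (pos-2m+n p r) (pos-2m+n q s)
    where
    pos-2m+n : ∀ m n → + (2 ℕ.* m ℕ.+ n) ≡ + 2 * + m + + n
    pos-2m+n m n = trans (pos-+ (2 ℕ.* m) n) (cong (_+ + n) (pos-* 2 m))

  ⟦mediantʳ⟧ : ∀ P R → ⟦ mediantʳ P R ⟧ ≡ ⟦ P ⟧ ⊕ + 2 ⊙ ⟦ R ⟧
  ⟦mediantʳ⟧ (p , q) (r , s) = cong₂ _,_ (pos-m+2n p r) (pos-m+2n q s)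
    where
    pos-m+2n : ∀ m n → + (m ℕ.+ 2 ℕ.* n) ≡ + m + + 2 * + n
    pos-m+2n m n = trans (pos-+ m (2 ℕ.* n)) (cong (λ x → + m + x) (pos-* 2 n))

  factor-nonneg : ∀ c {a} z .{{_ : ℕ.NonZero c}} → + a ≡ + c * z →
    Σ[ x ∈ ℕ ] (a ≡ c ℕ.* x × + x ≡ z)
  factor-nonneg c       (+ x)    a≡cz = x , +-injective (trans a≡cz (sym (pos-* c x))) , refl
  factor-nonneg (suc _) -[1+ _ ] ()

  ⊙-nonneg : ∀ c {Y} Z .{{_ : ℕ.NonZero c}} → ⟦ Y ⟧ ≡ + c ⊙ Z →
    Σ[ X ∈ Frac ] (Y ≡ c · X × ⟦ X ⟧ ≡ Z)
  ⊙-nonneg c (z , w) Y≡cZ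
    with factor-nonneg c z (cong proj₁ Y≡cZ) | factor-nonneg c w (cong proj₂ Y≡cZ)
  ... | x , a≡ , refl | y , b≡ , refl = (x , y) , cong₂ _,_ a≡ b≡ , refl

  reduce-gcd : ∀ {a b g} → gcd a b ≡ suc g → reduce (a , b) ≡ (a / suc g , b / suc g)
  reduce-gcd {a} {b} gcd≡ with gcd a b | gcd≡
  ... | _ | refl = refl

  reduce-reduced : ∀ {X} → Reduced X → reduce X ≡ X
  reduce-reduced {x , y} coprime =
    trans (reduce-gcd (coprime⇒gcd≡1 coprime)) (cong₂ _,_ (n/1≡n x) (n/1≡n y))

  reduce-· : ∀ c {X} .{{_ : ℕ.NonZero c}} → Reduced X → reduce (c · X) ≡ X
  reduce-· c@(suc _) {x , y} coprime = trans (reduce-gcd gcd≡c) (cong₂ _,_ (cancel x) (cancel y))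
    where
    gcd≡c : gcd (c ℕ.* x) (c ℕ.* y) ≡ c
    gcd≡c = begin
      gcd (c ℕ.* x) (c ℕ.* y) ≡⟨ c*gcd[m,n]≡gcd[cm,cn] c x y ⟨
      c ℕ.* gcd x y           ≡⟨ cong (c ℕ.*_) (coprime⇒gcd≡1 coprime) ⟩
      c ℕ.* 1                 ≡⟨ ℕ.*-identityʳ c ⟩
      c                       ∎
      where open ≡-Reasoning
    cancel : ∀ m → c ℕ.* m / c ≡ m
    cancel m = trans (cong (_/ c) (ℕ.*-comm c m)) (m*n/n≡m m c)

  +∣+ : ∀ {d a} → d ℕ.∣ a → + d ∣ + a
  +∣+ {d} {a} = ∣ᵤ⇒∣ {+ d} {+ a}

  ∣²-trans : ∀ {d e V} → d ∣ e → e ∣² V → d ∣² V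
  ∣²-trans d∣e (e∣a , e∣b) = ∣-trans d∣e e∣a , ∣-trans d∣e e∣b

  ∣²-⊙ : ∀ {d} k {V} → d ∣² V → d ∣² k ⊙ V
  ∣²-⊙ k (d∣a , d∣b) = ∣n⇒∣m*n k d∣a , ∣n⇒∣m*n k d∣b

  ⊙-mono-∣² : ∀ k {d V} → d ∣² V → k * d ∣² k ⊙ V
  ⊙-mono-∣² k (d∣a , d∣b) = *-monoʳ-∣ k d∣a , *-monoʳ-∣ k d∣b

  1∣² : ∀ V → + 1 ∣² V
  1∣² (a , b) = ∣ᵤ⇒∣ (ℕ.1∣ _) , ∣ᵤ⇒∣ (ℕ.1∣ _)

  ∣²⇒∣detˡ : ∀ {d} U V → d ∣² U → d ∣ det U V
  ∣²⇒∣detˡ (p , q) (r , s) (d∣p , d∣q) = ∣m∣n⇒∣m-n (∣m⇒∣m*n r d∣q) (∣m⇒∣m*n s d∣p)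

  ∣²⇒∣detʳ : ∀ {d} U V → d ∣² V → d ∣ det U V
  ∣²⇒∣detʳ (p , q) (r , s) (d∣r , d∣s) = ∣m∣n⇒∣m-n (∣n⇒∣m*n q d∣r) (∣n⇒∣m*n p d∣s)

  ∣²-cancelʳ : ∀ {d U V} → d ∣² V → d ∣² V ⊖ U ⊎ d ∣² V ⊕ U → d ∣² U
  ∣²-cancelʳ {U = u , u′} (d∣v , d∣v′) (inj₁ (d∣v-u , d∣v′-u′)) =
    minus d∣v d∣v-u , minus d∣v′ d∣v′-u′
    where
    minus : ∀ {d v u} → d ∣ v → d ∣ v - u → d ∣ u
    minus {u = u} d∣v d∣v-u = subst (_ ∣_) (neg-involutive u) (∣m⇒∣-m (∣m+n∣m⇒∣n d∣v-u d∣v))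
  ∣²-cancelʳ (d∣v , d∣v′) (inj₂ (d∣v+u , d∣v′+u′)) = ∣m+n∣m⇒∣n d∣v+u d∣v , ∣m+n∣m⇒∣n d∣v′+u′ d∣v′

  ∣²-cancelˡ : ∀ {d U V} → d ∣² U → d ∣² V ⊖ U ⊎ d ∣² V ⊕ U → d ∣² V
  ∣²-cancelˡ (d∣u , d∣u′) (inj₁ (d∣v-u , d∣v′-u′)) =
    ∣m+n∣n⇒∣m d∣v-u (∣m⇒∣-m d∣u) , ∣m+n∣n⇒∣m d∣v′-u′ (∣m⇒∣-m d∣u′)
  ∣²-cancelˡ (d∣u , d∣u′) (inj₂ (d∣v+u , d∣v′+u′)) = ∣m+n∣n⇒∣m d∣v+u d∣u , ∣m+n∣n⇒∣m d∣v′+u′ d∣u′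

  ∣-split : ∀ k {d u v} → k * d ∣ v - u → Σ[ δ ∈ ℤ ] (v ≡ u + k * δ × d ∣ δ)
  ∣-split k {d} {u} {v} (divides q v-u≡) = q * d , v≡ , divides q refl
    where
    identity₁ : ∀ u v → v ≡ u + (v - u)
    identity₁ = solve-∀
    identity₂ : ∀ q k d → q * (k * d) ≡ k * (q * d)
    identity₂ = solve-∀
    v≡ : v ≡ u + k * (q * d)
    v≡ = begin
      v               ≡⟨ identity₁ u v ⟩
      u + (v - u)     ≡⟨ cong (_+_ u) v-u≡ ⟩
      u + q * (k * d) ≡⟨ cong (_+_ u) (identity₂ q k d) ⟩
      u + k * (q * d) ∎
      where open ≡-Reasoning

  ∣²-split : ∀ k {d U V} → k * d ∣² V ⊖ U → Σ[ Δ ∈ ℤ² ] (V ≡ U ⊕ k ⊙ Δ × d ∣² Δ)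
  ∣²-split k (kd∣v-u , kd∣v′-u′) with ∣-split k kd∣v-u | ∣-split k kd∣v′-u′
  ... | δ , v≡ , d∣δ | δ′ , v′≡ , d∣δ′ = (δ , δ′) , cong₂ _,_ v≡ v′≡ , (d∣δ , d∣δ′)

  record Congruent (k : ℕ) (U V : ℤ²) : Set where
    constructor congruent
    field
      det≡ : det U V ≡ 3^ k
      ≡±   : 3^ k ∣² V ⊖ U ⊎ 3^ k ∣² V ⊕ U

  reduced-→ : ∀ {k X Y} → Reduced X → Congruent k ⟦ X ⟧ ⟦ Y ⟧ → Reduced Y
  reduced-→ {X = X} {Y = Y} coprime (congruent det≡ ≡±) (d∣a , d∣b) =
    coprime (∣⇒∣ᵤ (proj₁ d∣X) , ∣⇒∣ᵤ (proj₂ d∣X))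
    where
    d∣Y = +∣+ d∣a , +∣+ d∣b
    d∣3^k = subst (_ ∣_) det≡ (∣²⇒∣detʳ ⟦ X ⟧ ⟦ Y ⟧ d∣Y)
    d∣X = ∣²-cancelʳ {U = ⟦ X ⟧} d∣Y (Sum.map (∣²-trans d∣3^k) (∣²-trans d∣3^k) ≡±)

  reduced-← : ∀ {k X Y} → Reduced Y → Congruent k ⟦ X ⟧ ⟦ Y ⟧ → Reduced X
  reduced-← {X = X} {Y = Y} coprime (congruent det≡ ≡±) (d∣a , d∣b) =
    coprime (∣⇒∣ᵤ (proj₁ d∣Y) , ∣⇒∣ᵤ (proj₂ d∣Y))
    where
    d∣X = +∣+ d∣a , +∣+ d∣b
    d∣3^k = subst (_ ∣_) det≡ (∣²⇒∣detˡ ⟦ X ⟧ ⟦ Y ⟧ d∣X)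
    d∣Y = ∣²-cancelˡ {V = ⟦ Y ⟧} d∣X (Sum.map (∣²-trans d∣3^k) (∣²-trans d∣3^k) ≡±)

  det-mediantˡ : ∀ U V → det U (+ 2 ⊙ U ⊕ V) ≡ det U V
  det-mediantˡ (p , q) (r , s) = identity p q r s
    where
    identity : ∀ p q r s → q * (+ 2 * p + r) - p * (+ 2 * q + s) ≡ q * r - p * s
    identity = solve-∀

  det-mediants : ∀ U V → det (+ 2 ⊙ U ⊕ V) (U ⊕ + 2 ⊙ V) ≡ + 3 * det U V
  det-mediants (p , q) (r , s) = identity p q r s
    where
    identity : ∀ p q r s →
      (+ 2 * q + s) * (p + + 2 * r) - (+ 2 * p + r) * (q + + 2 * s) ≡ + 3 * (q * r - p * s)
    identity = solve-∀

  det-mediantʳ : ∀ U V → det (U ⊕ + 2 ⊙ V) V ≡ det U V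
  det-mediantʳ (p , q) (r , s) = identity p q r s
    where
    identity : ∀ p q r s → (q + + 2 * s) * r - (p + + 2 * r) * s ≡ q * r - p * s
    identity = solve-∀

  mediantˡ-⊖ : ∀ U V → + 2 ⊙ U ⊕ V ⊖ U ≡ V ⊕ U
  mediantˡ-⊖ (p , q) (r , s) = cong₂ _,_ (identity p r) (identity q s)
    where
    identity : ∀ u v → + 2 * u + v - u ≡ v + u
    identity = solve-∀

  mediants-⊕ : ∀ U V → U ⊕ + 2 ⊙ V ⊕ (+ 2 ⊙ U ⊕ V) ≡ + 3 ⊙ (V ⊕ U)
  mediants-⊕ (p , q) (r , s) = cong₂ _,_ (identity p r) (identity q s)
    where
    identity : ∀ u v → u + + 2 * v + (+ 2 * u + v) ≡ + 3 * (v + u)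
    identity = solve-∀

  ⊖-mediantʳ : ∀ U V → V ⊖ (U ⊕ + 2 ⊙ V) ≡ - + 1 ⊙ (V ⊕ U)
  ⊖-mediantʳ (p , q) (r , s) = cong₂ _,_ (identity p r) (identity q s)
    where
    identity : ∀ u v → v - (u + + 2 * v) ≡ - + 1 * (v + u)
    identity = solve-∀

  congruent-mediants : ∀ {k} U V → det U V ≡ 3^ k → 3^ k ∣² V ⊕ U →
    Congruent k U (+ 2 ⊙ U ⊕ V) ×
    Congruent (suc k) (+ 2 ⊙ U ⊕ V) (U ⊕ + 2 ⊙ V) ×
    Congruent k (U ⊕ + 2 ⊙ V) V
  congruent-mediants U V det≡ ∣V⊕U =
      congruent (trans (det-mediantˡ U V) det≡)
        (inj₁ (subst (_ ∣²_) (sym (mediantˡ-⊖ U V)) ∣V⊕U))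
    , congruent (trans (det-mediants U V) (cong (+ 3 *_) det≡))
        (inj₂ (subst (_ ∣²_) (sym (mediants-⊕ U V)) (⊙-mono-∣² (+ 3) ∣V⊕U)))
    , congruent (trans (det-mediantʳ U V) det≡)
        (inj₁ (subst (_ ∣²_) (sym (⊖-mediantʳ U V)) (∣²-⊙ (- + 1) ∣V⊕U)))

  det-translate : ∀ X Δ → det (X ⊕ Δ) (X ⊕ Δ ⊕ Δ) ≡ det X (X ⊕ Δ)
  det-translate (x , y) (d , e) = identity x y d e
    where
    identity : ∀ x y d e → (y + e) * (x + d + d) - (x + d) * (y + e + e) ≡ y * (x + d) - x * (y + e)
    identity = solve-∀

  det-⊕-3⊙ : ∀ X Δ → det X (X ⊕ + 3 ⊙ Δ) ≡ + 3 * det X (X ⊕ Δ)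
  det-⊕-3⊙ (x , y) (d , e) = identity x y d e
    where
    identity : ∀ x y d e → y * (x + + 3 * d) - x * (y + + 3 * e) ≡ + 3 * (y * (x + d) - x * (y + e))
    identity = solve-∀

  ⊕-⊖ : ∀ X Δ → X ⊕ Δ ⊖ X ≡ Δ
  ⊕-⊖ (x , y) (d , e) = cong₂ _,_ (identity x d) (identity y e)
    where
    identity : ∀ x d → x + d - x ≡ d
    identity = solve-∀

  congruent-step : ∀ {k} X Δ → det X (X ⊕ Δ) ≡ 3^ k → 3^ k ∣² Δ → Congruent k X (X ⊕ Δ)
  congruent-step X Δ det≡ ∣Δ = congruent det≡ (inj₁ (subst (_ ∣²_) (sym (⊕-⊖ X Δ)) ∣Δ))

  ⊕-3⊙ : ∀ X Δ → X ⊕ + 3 ⊙ Δ ≡ X ⊕ Δ ⊕ Δ ⊕ Δ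
  ⊕-3⊙ (x , y) (d , e) = cong₂ _,_ (identity x d) (identity y e)
    where
    identity : ∀ x d → x + + 3 * d ≡ x + d + d + d
    identity = solve-∀

  congruent-progression : ∀ {k} X Δ → det X (X ⊕ + 3 ⊙ Δ) ≡ 3^ (suc k) → 3^ k ∣² Δ →
    Congruent k X (X ⊕ Δ) ×
    Congruent k (X ⊕ Δ) (X ⊕ Δ ⊕ Δ) ×
    Congruent k (X ⊕ Δ ⊕ Δ) (X ⊕ + 3 ⊙ Δ)
  congruent-progression {k} X Δ det≡ ∣Δ =
      congruent-step X Δ det₀ ∣Δ
    , congruent-step (X ⊕ Δ) Δ det₁ ∣Δ
    , subst (Congruent k (X ⊕ Δ ⊕ Δ)) (sym (⊕-3⊙ X Δ))
        (congruent-step (X ⊕ Δ ⊕ Δ) Δ (trans (det-translate (X ⊕ Δ) Δ) det₁) ∣Δ)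
    where
    det₀ : det X (X ⊕ Δ) ≡ 3^ k
    det₀ = *-cancelˡ-≡ (+ 3) _ _ (trans (sym (det-⊕-3⊙ X Δ)) det≡)
    det₁ = trans (det-translate X Δ) det₀

  mediantˡ-progression : ∀ P R Δ → ⟦ R ⟧ ≡ ⟦ P ⟧ ⊕ + 3 ⊙ Δ →
    ⟦ mediantˡ P R ⟧ ≡ + 3 ⊙ (⟦ P ⟧ ⊕ Δ)
  mediantˡ-progression P@(p , q) R Δ@(d , e) R≡ = begin
    ⟦ mediantˡ P R ⟧                ≡⟨ ⟦mediantˡ⟧ P R ⟩
    + 2 ⊙ ⟦ P ⟧ ⊕ ⟦ R ⟧             ≡⟨ cong (λ V → + 2 ⊙ ⟦ P ⟧ ⊕ V) R≡ ⟩
    + 2 ⊙ ⟦ P ⟧ ⊕ (⟦ P ⟧ ⊕ + 3 ⊙ Δ) ≡⟨ cong₂ _,_ (identity (+ p) d) (identity (+ q) e) ⟩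
    + 3 ⊙ (⟦ P ⟧ ⊕ Δ)               ∎
    where
    open ≡-Reasoning
    identity : ∀ x d → + 2 * x + (x + + 3 * d) ≡ + 3 * (x + d)
    identity = solve-∀

  mediantʳ-progression : ∀ P R Δ → ⟦ R ⟧ ≡ ⟦ P ⟧ ⊕ + 3 ⊙ Δ →
    ⟦ mediantʳ P R ⟧ ≡ + 3 ⊙ (⟦ P ⟧ ⊕ Δ ⊕ Δ)
  mediantʳ-progression P@(p , q) R Δ@(d , e) R≡ = begin
    ⟦ mediantʳ P R ⟧                ≡⟨ ⟦mediantʳ⟧ P R ⟩
    ⟦ P ⟧ ⊕ + 2 ⊙ ⟦ R ⟧             ≡⟨ cong (λ V → ⟦ P ⟧ ⊕ + 2 ⊙ V) R≡ ⟩
    ⟦ P ⟧ ⊕ + 2 ⊙ (⟦ P ⟧ ⊕ + 3 ⊙ Δ) ≡⟨ cong₂ _,_ (identity (+ p) d) (identity (+ q) e) ⟩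
    + 3 ⊙ (⟦ P ⟧ ⊕ Δ ⊕ Δ)           ∎
    where
    open ≡-Reasoning
    identity : ∀ x d → x + + 2 * (x + + 3 * d) ≡ + 3 * (x + d + d)
    identity = solve-∀

  record Adjacent (P R : Frac) : Set where
    constructor adjacent
    field
      reducedˡ : Reduced P
      reducedʳ : Reduced R
      level : ℕ
      congruence : Congruent level ⟦ P ⟧ ⟦ R ⟧

  cross≡3^ : ∀ {k X Y} → Congruent k ⟦ X ⟧ ⟦ Y ⟧ → cross X Y ≡ 3^ k
  cross≡3^ {X = X} {Y} c = trans (cross≡det X Y) (Congruent.det≡ c)

  Splits : ℤ → Maybe ℤ × Maybe ℤ × Maybe ℤ → Set
  Splits V t = t ≡ (just V , just (+ 3 * V) , just V)
             ⊎ ∃[ W ] (+ 3 * W ≡ V × t ≡ (just W , just W , just W))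

  splits-V,3V,V : ∀ k {V x y z} → V ≡ 3^ k → x ≡ 3^ k → y ≡ 3^ (suc k) → z ≡ 3^ k →
    Splits V (just x , just y , just z)
  splits-V,3V,V _ refl refl refl refl = inj₁ refl

  splits-thirds : ∀ k {V x y z} → V ≡ 3^ (suc k) → x ≡ 3^ k → y ≡ 3^ k → z ≡ 3^ k →
    Splits V (just x , just y , just z)
  splits-thirds k refl refl refl refl = inj₂ (3^ k , refl , refl)

  record Refinement (P R : Frac) : Set where
    field
      A B : Frac
      inserted : insert2 P R ≡ A ∷ B ∷ []
      adjacentˡ : Adjacent P A
      adjacentᵐ : Adjacent A B
      adjacentʳ : Adjacent B R
      splits : Splits (cross P R) (just (cross P A) , just (cross A B) , just (cross B R))

  refine-mediants : ∀ {k P R} → Reduced P → Reduced R →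
    det ⟦ P ⟧ ⟦ R ⟧ ≡ 3^ k → 3^ k ∣² ⟦ R ⟧ ⊕ ⟦ P ⟧ → Refinement P R
  refine-mediants {k} {P} {R} rP rR det≡ ∣R⊕P = record
    { A = M
    ; B = N
    ; inserted = cong₂ (λ A B → A ∷ B ∷ []) (reduce-reduced rM) (reduce-reduced rN)
    ; adjacentˡ = adjacent rP rM k PM
    ; adjacentᵐ = adjacent rM rN (suc k) MN
    ; adjacentʳ = adjacent rN rR k NR
    ; splits = splits-V,3V,V k (trans (cross≡det P R) det≡)
                 (cross≡3^ PM) (cross≡3^ MN) (cross≡3^ NR)
    }
    where
    M = mediantˡ P R
    N = mediantʳ P R
    congruences = congruent-mediants {k} ⟦ P ⟧ ⟦ R ⟧ det≡ ∣R⊕P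
    PM : Congruent k ⟦ P ⟧ ⟦ M ⟧
    PM = subst (Congruent k ⟦ P ⟧) (sym (⟦mediantˡ⟧ P R)) (proj₁ congruences)
    MN : Congruent (suc k) ⟦ M ⟧ ⟦ N ⟧
    MN = subst₂ (Congruent (suc k)) (sym (⟦mediantˡ⟧ P R)) (sym (⟦mediantʳ⟧ P R))
           (proj₁ (proj₂ congruences))
    NR : Congruent k ⟦ N ⟧ ⟦ R ⟧
    NR = subst (λ W → Congruent k W ⟦ R ⟧) (sym (⟦mediantʳ⟧ P R)) (proj₂ (proj₂ congruences))
    rM = reduced-→ rP PM
    rN = reduced-← rR NR

  refine-progression : ∀ {k P R} Δ → Reduced P → Reduced R → ⟦ R ⟧ ≡ ⟦ P ⟧ ⊕ + 3 ⊙ Δ →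
    det ⟦ P ⟧ ⟦ R ⟧ ≡ 3^ (suc k) → 3^ k ∣² Δ → Refinement P R
  refine-progression {k} {P} {R} Δ rP rR R≡ det≡ ∣Δ
    with ⊙-nonneg 3 _ (mediantˡ-progression P R Δ R≡) | ⊙-nonneg 3 _ (mediantʳ-progression P R Δ R≡)
  ... | A , M≡3A , A≡ | B , N≡3B , B≡ = record
    { A = A
    ; B = B
    ; inserted = cong₂ (λ A B → A ∷ B ∷ [])
                   (trans (cong reduce M≡3A) (reduce-· 3 rA))
                   (trans (cong reduce N≡3B) (reduce-· 3 rB))
    ; adjacentˡ = adjacent rP rA k PA
    ; adjacentᵐ = adjacent rA rB k AB
    ; adjacentʳ = adjacent rB rR k BR
    ; splits = splits-thirds k (trans (cross≡det P R) det≡)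
                 (cross≡3^ PA) (cross≡3^ AB) (cross≡3^ BR)
    }
    where
    congruences = congruent-progression {k} ⟦ P ⟧ Δ (trans (cong (det ⟦ P ⟧) (sym R≡)) det≡) ∣Δ
    PA : Congruent k ⟦ P ⟧ ⟦ A ⟧
    PA = subst (Congruent k ⟦ P ⟧) (sym A≡) (proj₁ congruences)
    AB : Congruent k ⟦ A ⟧ ⟦ B ⟧
    AB = subst₂ (Congruent k) (sym A≡) (sym B≡) (proj₁ (proj₂ congruences))
    BR : Congruent k ⟦ B ⟧ ⟦ R ⟧
    BR = subst₂ (Congruent k) (sym B≡) (sym R≡) (proj₂ (proj₂ congruences))
    rA = reduced-→ rP PA
    rB = reduced-→ rA AB

  refine : ∀ {P R} → Adjacent P R → Refinement P R
  refine (adjacent rP rR k (congruent det≡ (inj₂ ∣R⊕P))) = refine-mediants {k} rP rR det≡ ∣R⊕P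
  refine (adjacent rP rR zero (congruent det≡ (inj₁ _))) = refine-mediants {zero} rP rR det≡ (1∣² _)
  refine {P} (adjacent rP rR (suc k) (congruent det≡ (inj₁ ∣R⊖P)))
    with ∣²-split (+ 3) {U = ⟦ P ⟧} ∣R⊖P
  ... | Δ , R≡ , ∣Δ = refine-progression {k} Δ rP rR R≡ det≡ ∣Δ

open import Data.Nat using (_+_; _*_; _^_; _<_)

∷-step : ∀ {R : Frac → Frac → Set} {x b rest} →
  R x b → Linked R (step (b ∷ rest)) → Linked R (x ∷ step (b ∷ rest))
∷-step {rest = []}    Rxb linked = Rxb ∷ linked
∷-step {rest = _ ∷ _} Rxb linked = Rxb ∷ linked

step-adjacent : ∀ {xs} → Linked Adjacent xs → Linked Adjacent (step xs)
step-adjacent [] = []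
step-adjacent [-] = [-]
step-adjacent {a ∷ b ∷ rest} (ab ∷ linked) =
  subst (λ ys → Linked Adjacent (a ∷ ys ++ step (b ∷ rest))) (sym inserted)
    (adjacentˡ ∷ adjacentᵐ ∷ ∷-step adjacentʳ (step-adjacent linked))
  where open Refinement (refine ab)

adjacent-SB : ∀ n → Linked Adjacent (SB n)
adjacent-SB zero =
  adjacent (gcd≡1⇒coprime refl) (gcd≡1⇒coprime refl) 0 (congruent refl (inj₂ (1∣² _))) ∷ [-]
adjacent-SB (suc n) = step-adjacent (adjacent-SB n)

Linked-drop : ∀ {A : Set} {R : A → A → Set} i {xs} → Linked R xs → Linked R (drop i xs)
Linked-drop zero linked = linked
Linked-drop (suc i) {[]} [] = []
Linked-drop (suc i) {_ ∷ _} linked = Linked-drop i (tail linked)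

drop-step : ∀ i xs {a b rest} → drop i xs ≡ a ∷ b ∷ rest →
  drop (3 * i) (step xs) ≡ a ∷ insert2 a b ++ step (b ∷ rest)
drop-step zero _ refl = refl
drop-step (suc i) (x ∷ y ∷ zs) {a} {b} {rest} eq =
  subst (λ m → drop m (step (x ∷ y ∷ zs)) ≡ a ∷ insert2 a b ++ step (b ∷ rest))
    (sym (ℕ.*-suc 3 i)) (drop-step i (y ∷ zs) eq)
drop-step (suc i) (x ∷ []) eq = contradiction (trans (sym (drop-[] i)) eq) λ ()
drop-step (suc i) [] ()

crossHead : List Frac → Maybe ℤ
crossHead (a ∷ b ∷ _) = just (cross a b)
crossHead _ = nothing

crossAt≡crossHead : ∀ xs i → crossAt xs i ≡ crossHead (drop i xs)
crossAt≡crossHead xs i with drop i xs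
... | [] = refl
... | _ ∷ [] = refl
... | _ ∷ _ ∷ _ = refl

crossAt-+ : ∀ xs i j → crossAt xs (i + j) ≡ crossHead (drop j (drop i xs))
crossAt-+ xs i j = trans (crossAt≡crossHead xs (i + j)) (cong crossHead (sym (drop-drop i j xs)))

crossHead-just : ∀ {xs V} → crossHead xs ≡ just V →
  ∃[ a ] ∃[ b ] ∃[ rest ] (xs ≡ a ∷ b ∷ rest × cross a b ≡ V)
crossHead-just {a ∷ b ∷ rest} refl = a , b , rest , refl , refl

crossHead-step : ∀ x b rest → crossHead (x ∷ step (b ∷ rest)) ≡ just (cross x b)
crossHead-step x b [] = refl
crossHead-step x b (_ ∷ _) = refl

crossAt-window : ∀ i xs {a A B b rest} → drop i xs ≡ a ∷ A ∷ B ∷ step (b ∷ rest) →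
  (crossAt xs i , crossAt xs (i + 1) , crossAt xs (i + 2))
    ≡ (just (cross a A) , just (cross A B) , just (cross B b))
crossAt-window i xs {B = B} {b} {rest} eq = cong₂ _,_
  (trans (crossAt≡crossHead xs i) (cong crossHead eq))
  (cong₂ _,_
    (trans (crossAt-+ xs i 1) (cong (λ ys → crossHead (drop 1 ys)) eq))
    (trans (crossAt-+ xs i 2)
      (trans (cong (λ ys → crossHead (drop 2 ys)) eq) (crossHead-step B b rest))))

-- The range hypothesis i < 3 ^ n is implied by C n i ≡ just V.
lemma11 : (n i : ℕ) → i < 3 ^ n → (V : ℤ) → C n i ≡ just V →
    ((C (1 + n) (3 * i) , C (1 + n) (3 * i + 1) , C (1 + n) (3 * i + 2)) ≡ (just V , just (+ 3 ℤ.* V) , just V))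
    ⊎ (∃[ W ] (+ 3 ℤ.* W ≡ V × (C (1 + n) (3 * i) , C (1 + n) (3 * i + 1) , C (1 + n) (3 * i + 2)) ≡ (just W , just W , just W)))
lemma11 n i _ V Cni≡V with crossHead-just (trans (sym (crossAt≡crossHead (SB n) i)) Cni≡V)
... | a , b , rest , drop≡ , refl =
  subst (Splits (cross a b)) (sym (crossAt-window (3 * i) (SB (1 + n)) window)) splits
  where
  open Refinement (refine (head (subst (Linked Adjacent) drop≡ (Linked-drop i (adjacent-SB n)))))
  window : drop (3 * i) (SB (1 + n)) ≡ a ∷ A ∷ B ∷ step (b ∷ rest)
  window = trans (drop-step i (SB n) drop≡) (cong (λ ys → a ∷ ys ++ step (b ∷ rest)) inserted)
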